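{- Let $F_k$ be a non-abelian free group and let $NE(p,q)\subseteq F_k\times F_k$ be the definable set $$NE(p,q)=\{(p,q)\;:\;\exists x_1,x_2\in F_k\ \ qp=x_1^{10}x_2^{ -9}\ \wedge\ [x_1,x_2]\neq 1\}.$$ Then $NE(p,q)$ is not equational (with respect to the partition of variables into $p$ and $q$).
   Context: For a definable set $D(p,q)$ in a structure, write $D(p,q_0)=\{p_0:(p_0,q_0)\in D\}$. $D(p,q)$ is equational (in the sense of Srour) if there is a constant $N_D$ such that for every finite sequence of values $q_1,\dots,q_m$ for which the sequence of intersections $\big\{\bigcap_{i=1}^{j} D(p,q_i)\big\}_{j=1}^{m}$ is strictly decreasing, one has $m\le N_D$. Here $[x_1,x_2]$ denotes the commutator. -}

module Defs where

open import Data.Nat using (ℕ; zero; suc; _≤_)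
open import Data.Fin using (Fin; toℕ)
open import Data.Fin.Properties using () renaming (_≟_ to _≟ᶠ_)
open import Data.Bool using (Bool; true; false; not; if_then_else_)
open import Data.Bool.Properties using () renaming (_≟_ to _≟ᵇ_)
open import Data.List using (List; []; _∷_; _++_; reverse; map)
open import Data.Product using (Σ; _×_; _,_)
open import Relation.Nullary using (¬_; yes; no; Dec)
open import Relation.Binary.PropositionalEquality using (_≡_)

-- The free group F_k on generators a_0,…,a_{k-1}.
-- A letter is a generator together with a flag (true = the inverse a_i⁻¹).
Letter : ℕ → Set
Letter k = Fin k × Bool

-- Elements of F_k are represented by words; two words denote the same element
-- iff they have the same free reduction.
Word : ℕ → Set
Word k = List (Letter k)

cancels : ∀ {k} → Letter k → Letter k → Bool
cancels (i , e) (j , f) with i ≟ᶠ j | e ≟ᵇ f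
... | yes _ | no _ = true
... | _     | _    = false

push : ∀ {k} → Letter k → Word k → Word k
push a [] = a ∷ []
push a (b ∷ w) = if cancels a b then w else (a ∷ b ∷ w)

reduce : ∀ {k} → Word k → Word k
reduce [] = []
reduce (a ∷ w) = push a (reduce w)

_≈_ : ∀ {k} → Word k → Word k → Set
u ≈ v = reduce u ≡ reduce v

infix 4 _≈_

_·_ : ∀ {k} → Word k → Word k → Word k
u · v = u ++ v

infixl 7 _·_

one : ∀ {k} → Word k
one = []

inv : ∀ {k} → Word k → Word k
inv w = reverse (map (λ { (i , e) → (i , not e) }) w)

pow : ∀ {k} → ℕ → Word k → Word k
pow zero w = one
pow (suc n) w = w · pow n w

comm : ∀ {k} → Word k → Word k → Word k
comm x y = inv x · inv y · x · y

NE : ∀ {k} → Word k → Word k → Set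
NE {k} p q = Σ (Word k) λ x₁ → Σ (Word k) λ x₂ →
  (q · p ≈ pow 10 x₁ · pow 9 (inv x₂)) × ¬ (comm x₁ x₂ ≈ one)

module Equational {A : Set} (D : A → A → Set) where

  -- p ∈ ⋂_{i=1}^{j} D(p,q_i), indices 0-based: i < j
  InterUpTo : ∀ {m} → (Fin m → A) → ℕ → A → Set
  InterUpTo {m} q j p = (i : Fin m) → suc (toℕ i) ≤ j → D p (q i)

  _⊆_ : (A → Set) → (A → Set) → Set
  P ⊆ Q = ∀ a → P a → Q a

  _⊊_ : (A → Set) → (A → Set) → Set
  P ⊊ Q = (P ⊆ Q) × ¬ (Q ⊆ P)

  StrictlyDecreasing : ∀ {m} → (Fin m → A) → Set
  StrictlyDecreasing {m} q =
    ∀ j → 1 ≤ j → suc j ≤ m → InterUpTo q (suc j) ⊊ InterUpTo q j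

  IsEquational : Set
  IsEquational = Σ ℕ λ N → ∀ m (q : Fin m → A) → StrictlyDecreasing q → m ≤ N

-- Let a₀, a₁ be the first two generators and hₙ = a₁ⁿ a₀. Put qᵢ = (hᵢ⁹)¹⁰ and
-- pⱼ = ((hⱼ¹⁰)⁻¹)⁹. For i < j we have qᵢ pⱼ = x₁¹⁰ x₂⁻⁹ with x₁ = hᵢ⁹ and x₂ = hⱼ¹⁰, and
-- these do not commute: otherwise hᵢ and hⱼ would commute (roots are unique in a free
-- group), but they act differently on ℤ via a₀ ↦ (x ↦ −x), a₁ ↦ (x ↦ x + 1). So pⱼ lies in
-- NE(p, qᵢ) for every i < j. On the other hand qⱼ pⱼ = 1, and x₁¹⁰ = x₂⁹ makes x₁ commute
-- with x₂⁹, hence with x₂ by uniqueness of roots; so pⱼ ∉ NE(p, qⱼ), and the intersections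
-- ⋂_{i ≤ j} NE(p, qᵢ) decrease strictly for ever.
--
-- Uniqueness of roots: a reduced word is u c u⁻¹ with c cyclically reduced, its n-th power
-- reduces to u cⁿ u⁻¹, and u and cⁿ (hence c) can be read off from that word.

module Submission where

open import Algebra.Bundles using (Group)
import Algebra.Properties.Group as GroupProperties
import Algebra.Properties.Monoid.Mult as MonoidMult
open import Data.Bool using (true; false; not)
open import Data.Bool.Properties using () renaming (_≟_ to _≟ᵇ_)
open import Data.Fin using (zero; suc; toℕ; fromℕ<)
open import Data.Fin.Properties using (toℕ-fromℕ<) renaming (_≟_ to _≟ᶠ_)
open import Data.List using (List; []; _∷_; _++_; _∷ʳ_; map; foldr; head; last; length)
open import Data.List.Properties
  using (++-monoid; ++-assoc; ++-identityʳ; ∷-injective; ∷ʳ-injectiveˡ; foldr-++; unfold-reverse;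
         length-++; length-++-≤ˡ)
open import Data.List.Reverse using (reverseView; []; _∶_∶ʳ_)
open import Data.List.Relation.Unary.Linked as Linked using (Linked; []; [-]; _∷_)
open import Data.List.Relation.Unary.Linked.Properties using () renaming (++⁺ to Linked-++⁺)
open import Data.Maybe using (just)
open import Data.Maybe.Relation.Binary.Connected using (Connected; just; just-nothing; nothing-just; nothing)
open import Data.Nat using (ℕ; zero; suc; _+_; _*_; _≤_; _<_; s≤s; s<s)
open import Data.Nat.Properties
  using (*-comm; +-comm; ≤-trans; ≤-refl; ≤-reflexive; suc-injective; *-cancelˡ-≡; m≤n⇒m≤1+n; 1+n≰n)
open import Data.Product using (_×_; _,_; proj₁; proj₂)
open import Function using (_∘_)
open import Level using (0ℓ; _⊔_)
open import Relation.Binary using (Rel; Setoid; IsEquivalence)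
import Relation.Binary.Construct.On as On
open import Relation.Binary.PropositionalEquality
  using (_≡_; _≢_; refl; sym; trans; cong; cong₂; subst; isEquivalence; module ≡-Reasoning)
open import Relation.Nullary using (¬_; yes; no; contradiction)
open import Tactic.MonoidSolver using (solve)

module _ {a} {A : Set a} where

  head-++ : ∀ {ys ys′ : List A} zs → head ys′ ≡ head ys → head (ys′ ++ zs) ≡ head (ys ++ zs)
  head-++ {[]}    {[]}    zs _ = refl
  head-++ {_ ∷ _} {_ ∷ _} zs e = e
  head-++ {[]}    {_ ∷ _} zs ()
  head-++ {_ ∷ _} {[]}    zs ()

  ++-injectiveˡ : ∀ (xs ys : List A) {zs ws} → length xs ≡ length ys → xs ++ zs ≡ ys ++ ws → xs ≡ ys
  ++-injectiveˡ []       []       _   _ = refl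
  ++-injectiveˡ (x ∷ xs) (y ∷ ys) len e with ∷-injective e
  ... | refl , e′ = cong (x ∷_) (++-injectiveˡ xs ys (suc-injective len) e′)

  last-++ : ∀ (xs : List A) y ys → last (xs ++ y ∷ ys) ≡ last (y ∷ ys)
  last-++ []            y ys = refl
  last-++ (x ∷ [])      y ys = refl
  last-++ (x ∷ x′ ∷ xs) y ys = last-++ (x′ ∷ xs) y ys

module _ {a ℓ} {A : Set a} {R : Rel A ℓ} where

  Linked-++⁻ : ∀ xs {ys} → Linked R (xs ++ ys) →
               Linked R xs × Connected R (last xs) (head ys) × Linked R ys
  Linked-++⁻ []            {[]}    l       = [] , nothing , l
  Linked-++⁻ []            {_ ∷ _} l       = [] , nothing-just , l
  Linked-++⁻ (x ∷ [])      {[]}    l       = [-] , just-nothing , []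
  Linked-++⁻ (x ∷ [])      {_ ∷ _} (r ∷ l) = [-] , just r , l
  Linked-++⁻ (x ∷ x′ ∷ xs)         (r ∷ l) with Linked-++⁻ (x′ ∷ xs) l
  ... | lxs , c , lys = r ∷ lxs , c , lys

  Linked-replace : ∀ xs {ys ys′ zs} → head ys′ ≡ head ys → last ys′ ≡ last ys →
                   Linked R ys′ → Linked R (xs ++ ys ++ zs) → Linked R (xs ++ ys′ ++ zs)
  Linked-replace xs {ys} {ys′} {zs} h≡ l≡ lys′ l with Linked-++⁻ xs l
  ... | lxs , cx , lyzs with Linked-++⁻ ys lyzs
  ... | _ , cy , lzs = Linked-++⁺ lxs (subst (Connected R (last xs)) (sym (head-++ zs h≡)) cx)
                         (Linked-++⁺ lys′ (subst (λ l′ → Connected R l′ (head zs)) (sym l≡) cy) lzs)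

-- Commuting elements and roots in groups

module GroupFacts {c ℓ} (G : Group c ℓ) where

  open Group G hiding (refl; sym; trans)
  open Group G using () renaming (sym to ≈-sym; trans to ≈-trans)
  open GroupProperties G
  open MonoidMult monoid using (×-homo-+; ×-homo-1; ×-assocˡ; ×-congˡ) renaming (_×_ to _×ᴹ_)
  open import Relation.Binary.Reasoning.Setoid setoid

  infixr 8 _^_
  _^_ : Carrier → ℕ → Carrier
  x ^ n = n ×ᴹ x

  [_,_] : Carrier → Carrier → Carrier
  [ x , y ] = x ⁻¹ ∙ y ⁻¹ ∙ x ∙ y

  Commute : Carrier → Carrier → Set ℓ
  Commute x y = x ∙ y ≈ y ∙ x

  UniqueRoots : ℕ → Set (c ⊔ ℓ)
  UniqueRoots n = ∀ x y → x ^ n ≈ y ^ n → x ≈ y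

  [,]-as-quotient : ∀ x y → [ x , y ] ≈ (y ∙ x) ⁻¹ ∙ (x ∙ y)
  [,]-as-quotient x y = begin
    x ⁻¹ ∙ y ⁻¹ ∙ x ∙ y     ≈⟨ solve monoid ⟩
    (x ⁻¹ ∙ y ⁻¹) ∙ (x ∙ y) ≈⟨ ∙-congʳ (⁻¹-anti-homo-∙ y x) ⟨
    (y ∙ x) ⁻¹ ∙ (x ∙ y)    ∎

  [,]≈ε⇒commute : ∀ {x y} → [ x , y ] ≈ ε → Commute x y
  [,]≈ε⇒commute {x} {y} e =
    ≈-sym (⁻¹-injective (inverseˡ-unique ((y ∙ x) ⁻¹) (x ∙ y) (≈-trans (≈-sym ([,]-as-quotient x y)) e)))

  commute⇒[,]≈ε : ∀ {x y} → Commute x y → [ x , y ] ≈ ε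
  commute⇒[,]≈ε {x} {y} c = begin
    [ x , y ]              ≈⟨ [,]-as-quotient x y ⟩
    (y ∙ x) ⁻¹ ∙ (x ∙ y)   ≈⟨ ∙-congˡ c ⟩
    (y ∙ x) ⁻¹ ∙ (y ∙ x)   ≈⟨ inverseˡ (y ∙ x) ⟩
    ε                      ∎

  conjugate≈⇒commute : ∀ {x y} → x ∙ y ∙ x ⁻¹ ≈ y → Commute x y
  conjugate≈⇒commute {x} {y} e = begin
    x ∙ y               ≈⟨ //-rightDividesˡ x (x ∙ y) ⟨
    x ∙ y ∙ x ⁻¹ ∙ x    ≈⟨ ∙-congʳ e ⟩
    y ∙ x               ∎

  commute⇒conjugate≈ : ∀ {x y} → Commute x y → x ∙ y ∙ x ⁻¹ ≈ y
  commute⇒conjugate≈ {x} {y} c = begin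
    x ∙ y ∙ x ⁻¹   ≈⟨ ∙-congʳ c ⟩
    y ∙ x ∙ x ⁻¹   ≈⟨ //-rightDividesʳ x y ⟩
    y              ∎

  conjugate-^ : ∀ x y n → (x ∙ y ∙ x ⁻¹) ^ n ≈ x ∙ y ^ n ∙ x ⁻¹
  conjugate-^ x y zero = begin
    ε            ≈⟨ inverseʳ x ⟨
    x ∙ x ⁻¹     ≈⟨ ∙-congʳ (identityʳ x) ⟨
    x ∙ ε ∙ x ⁻¹ ∎
  conjugate-^ x y (suc n) = begin
    (x ∙ y ∙ x ⁻¹) ∙ (x ∙ y ∙ x ⁻¹) ^ n    ≈⟨ ∙-congˡ (conjugate-^ x y n) ⟩
    (x ∙ y ∙ x ⁻¹) ∙ (x ∙ y ^ n ∙ x ⁻¹)    ≈⟨ solve monoid ⟩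
    x ∙ y ∙ (x ⁻¹ ∙ (x ∙ (y ^ n ∙ x ⁻¹)))  ≈⟨ ∙-congˡ (\\-leftDividesʳ x (y ^ n ∙ x ⁻¹)) ⟩
    x ∙ y ∙ (y ^ n ∙ x ⁻¹)                 ≈⟨ solve monoid ⟩
    x ∙ (y ∙ y ^ n) ∙ x ⁻¹                 ∎

  commute-^⇒commute : ∀ n {x y} → UniqueRoots n → Commute x (y ^ n) → Commute x y
  commute-^⇒commute n {x} {y} roots c = conjugate≈⇒commute (roots (x ∙ y ∙ x ⁻¹) y (begin
    (x ∙ y ∙ x ⁻¹) ^ n  ≈⟨ conjugate-^ x y n ⟩
    x ∙ y ^ n ∙ x ⁻¹    ≈⟨ commute⇒conjugate≈ c ⟩
    y ^ n               ∎))

  ^-commute⇒commute : ∀ m n {x y} → UniqueRoots m → UniqueRoots n →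
                      Commute (x ^ m) (y ^ n) → Commute x y
  ^-commute⇒commute m n rm rn c =
    ≈-sym (commute-^⇒commute m rm (≈-sym (commute-^⇒commute n rn c)))

  commute-^ : ∀ x n → Commute x (x ^ n)
  commute-^ x n = begin
    x ^ suc n        ≈⟨ ×-congˡ (+-comm 1 n) ⟩
    x ^ (n + 1)      ≈⟨ ×-homo-+ x n 1 ⟩
    x ^ n ∙ x ^ 1    ≈⟨ ∙-congˡ (×-homo-1 x) ⟩
    x ^ n ∙ x        ∎

  xⁿ∙x⁻¹ⁿ≈ε : ∀ x n → x ^ n ∙ (x ⁻¹) ^ n ≈ ε
  xⁿ∙x⁻¹ⁿ≈ε x zero = identityˡ ε
  xⁿ∙x⁻¹ⁿ≈ε x (suc n) = begin
    x ∙ x ^ n ∙ (x ⁻¹) ^ suc n             ≈⟨ ∙-congˡ (commute-^ (x ⁻¹) n) ⟩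
    x ∙ x ^ n ∙ ((x ⁻¹) ^ n ∙ x ⁻¹)        ≈⟨ solve monoid ⟩
    x ∙ (x ^ n ∙ (x ⁻¹) ^ n) ∙ x ⁻¹        ≈⟨ ∙-congʳ (∙-congˡ (xⁿ∙x⁻¹ⁿ≈ε x n)) ⟩
    x ∙ ε ∙ x ⁻¹                           ≈⟨ ∙-congʳ (identityʳ x) ⟩
    x ∙ x ⁻¹                               ≈⟨ inverseʳ x ⟩
    ε                                      ∎

  ⁻¹-^ : ∀ x n → (x ⁻¹) ^ n ≈ (x ^ n) ⁻¹
  ⁻¹-^ x n = inverseʳ-unique (x ^ n) ((x ⁻¹) ^ n) (xⁿ∙x⁻¹ⁿ≈ε x n)

  xᵐ∙y⁻¹ⁿ≈ε⇒commute : ∀ m n {x y} → UniqueRoots n → x ^ m ∙ (y ⁻¹) ^ n ≈ ε → Commute x y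
  xᵐ∙y⁻¹ⁿ≈ε⇒commute m n {x} {y} roots e = commute-^⇒commute n roots (begin
    x ∙ y ^ n    ≈⟨ ∙-congˡ xᵐ≈yⁿ ⟨
    x ∙ x ^ m    ≈⟨ commute-^ x m ⟩
    x ^ m ∙ x    ≈⟨ ∙-congʳ xᵐ≈yⁿ ⟩
    y ^ n ∙ x    ∎)
    where
    xᵐ≈yⁿ : x ^ m ≈ y ^ n
    xᵐ≈yⁿ = x∙y⁻¹≈ε⇒x≈y (x ^ m) (y ^ n) (≈-trans (∙-congˡ (≈-sym (⁻¹-^ y n))) e)

  xᵐⁿ∙xⁿ⁻¹ᵐ≈ε : ∀ x m n → (x ^ m) ^ n ∙ ((x ^ n) ⁻¹) ^ m ≈ ε
  xᵐⁿ∙xⁿ⁻¹ᵐ≈ε x m n = begin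
    (x ^ m) ^ n ∙ ((x ^ n) ⁻¹) ^ m   ≈⟨ ∙-cong (×-assocˡ x n m) (⁻¹-^ (x ^ n) m) ⟩
    x ^ (n * m) ∙ ((x ^ n) ^ m) ⁻¹   ≈⟨ ∙-congˡ (⁻¹-cong (×-assocˡ x m n)) ⟩
    x ^ (n * m) ∙ (x ^ (m * n)) ⁻¹   ≈⟨ ∙-congˡ (⁻¹-cong (×-congˡ (*-comm m n))) ⟩
    x ^ (n * m) ∙ (x ^ (n * m)) ⁻¹   ≈⟨ inverseʳ (x ^ (n * m)) ⟩
    ε                                ∎

-- Ladders and non-equationality

open import Defs

module _ {A : Set} (D : A → A → Set) where

  open Equational D

  ladder⇒¬equational : (p q : ℕ → A) → (∀ {i j} → i < j → D (p j) (q i)) → (∀ j → ¬ D (p j) (q j)) →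
                       ¬ IsEquational
  ladder⇒¬equational p q below off-diagonal (N , bound) = 1+n≰n (bound (suc N) (q ∘ toℕ) decreasing)
    where
    decreasing : StrictlyDecreasing (q ∘ toℕ)
    decreasing j _ j<m = shrinks , λ grows → off-diagonal j (subst (D (p j) ∘ q) (toℕ-fromℕ< j<m)
      (grows (p j) (λ i i<j → below i<j) (fromℕ< j<m) (≤-reflexive (cong suc (toℕ-fromℕ< j<m)))))
      where
      shrinks : InterUpTo (q ∘ toℕ) (suc j) ⊆ InterUpTo (q ∘ toℕ) j
      shrinks _ P i i<j = P i (m≤n⇒m≤1+n i<j)

-- Free reduction and the free group

module _ {k : ℕ} where

  invert : Letter k → Letter k
  invert (i , e) = (i , not e)

  invert-involutive : ∀ a → invert (invert a) ≡ a
  invert-involutive (i , false) = refl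
  invert-involutive (i , true)  = refl

  cancels⇒≡invert : ∀ a b → cancels a b ≡ true → b ≡ invert a
  cancels⇒≡invert (i , e) (j , f) eq with i ≟ᶠ j | e ≟ᵇ f
  cancels⇒≡invert (i , false) (.i , true)  eq | yes refl | no _ = refl
  cancels⇒≡invert (i , true)  (.i , false) eq | yes refl | no _ = refl
  cancels⇒≡invert (i , false) (.i , false) eq | yes refl | no e≢f = contradiction refl e≢f
  cancels⇒≡invert (i , true)  (.i , true)  eq | yes refl | no e≢f = contradiction refl e≢f
  cancels⇒≡invert (i , e) (j , f) () | yes _ | yes _
  cancels⇒≡invert (i , e) (j , f) () | no _  | _

  cancels-invert : ∀ a → cancels a (invert a) ≡ true
  cancels-invert (i , e) with i ≟ᶠ i | e ≟ᵇ not e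
  ... | yes _ | no _   = refl
  ... | no i≢i | _     = contradiction refl i≢i
  cancels-invert (i , false) | yes _ | yes ()
  cancels-invert (i , true)  | yes _ | yes ()

  cancels-self : ∀ (a : Letter k) → cancels a a ≡ false
  cancels-self (i , e) with i ≟ᶠ i | e ≟ᵇ e
  ... | yes _ | yes _  = refl
  ... | no _  | _      = refl
  ... | yes _ | no e≢e = contradiction refl e≢e

  cancels-sym : ∀ a b → cancels a b ≡ true → cancels b a ≡ true
  cancels-sym a b ab = subst (λ a′ → cancels b a′ ≡ true)
    (trans (cong invert (cancels⇒≡invert a b ab)) (invert-involutive a)) (cancels-invert b)

  cancels-cancels⇒≡ : ∀ a b c → cancels a b ≡ true → cancels b c ≡ true → a ≡ c
  cancels-cancels⇒≡ a b c ab bc = begin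
    a                    ≡⟨ invert-involutive a ⟨
    invert (invert a)    ≡⟨ cong invert (cancels⇒≡invert a b ab) ⟨
    invert b             ≡⟨ cancels⇒≡invert b c bc ⟨
    c                    ∎
    where open ≡-Reasoning

  NonCancelling : Rel (Letter k) 0ℓ
  NonCancelling a b = cancels a b ≡ false

  Reduced : Word k → Set
  Reduced = Linked NonCancelling

  push-cancel : ∀ {a b : Letter k} w → cancels a b ≡ true → push a (b ∷ w) ≡ w
  push-cancel w ab rewrite ab = refl

  push-reduced : ∀ a {w} → Reduced w → Reduced (push a w)
  push-reduced a {[]}    _ = [-]
  push-reduced a {b ∷ w} r with cancels a b in ab
  ... | true  = Linked.tail r
  ... | false = ab ∷ r

  push-onto-reduced : ∀ a w → Reduced (a ∷ w) → push a w ≡ a ∷ w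
  push-onto-reduced a []      _       = refl
  push-onto-reduced a (b ∷ w) (ab ∷ _) rewrite ab = refl

  push-push : ∀ {a b} w → cancels a b ≡ true → Reduced w → push a (push b w) ≡ w
  push-push []      ab _ = push-cancel [] ab
  push-push {a} {b} (c ∷ w) ab r with cancels b c in bc
  ... | false = push-cancel (c ∷ w) ab
  ... | true rewrite cancels-cancels⇒≡ a b c ab bc = push-onto-reduced c w r

  reduce-reduced : ∀ w → Reduced (reduce w)
  reduce-reduced []      = []
  reduce-reduced (a ∷ w) = push-reduced a (reduce-reduced w)

  reduce-id : ∀ {w} → Reduced w → reduce w ≡ w
  reduce-id {[]}    _ = refl
  reduce-id {a ∷ w} r = trans (cong (push a) (reduce-id (Linked.tail r))) (push-onto-reduced a w r)

  pushAll : Word k → Word k → Word k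
  pushAll u r = foldr push r u

  reduce-++ : ∀ u v → reduce (u ++ v) ≡ pushAll u (reduce v)
  reduce-++ []      v = refl
  reduce-++ (a ∷ u) v = cong (push a) (reduce-++ u v)

  pushAll-reduced : ∀ u {r} → Reduced r → Reduced (pushAll u r)
  pushAll-reduced []      rr = rr
  pushAll-reduced (a ∷ u) rr = push-reduced a (pushAll-reduced u rr)

  pushAll-push : ∀ a s {r} → Reduced r → pushAll (push a s) r ≡ push a (pushAll s r)
  pushAll-push a []      rr = refl
  pushAll-push a (b ∷ s) {r} rr with cancels a b in ab
  ... | true  = sym (push-push (pushAll s r) ab (pushAll-reduced s rr))
  ... | false = refl

  pushAll-reduce : ∀ u {r} → Reduced r → pushAll u r ≡ pushAll (reduce u) r
  pushAll-reduce []      rr = refl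
  pushAll-reduce (a ∷ u) rr =
    trans (cong (push a) (pushAll-reduce u rr)) (sym (pushAll-push a (reduce u) rr))

  ·-cong : ∀ {x x′ y y′ : Word k} → x ≈ x′ → y ≈ y′ → x · y ≈ x′ · y′
  ·-cong {x} {x′} {y} {y′} x≈x′ y≈y′ = begin
    reduce (x ++ y)                   ≡⟨ reduce-++ x y ⟩
    pushAll x (reduce y)              ≡⟨ pushAll-reduce x (reduce-reduced y) ⟩
    pushAll (reduce x) (reduce y)     ≡⟨ cong₂ pushAll x≈x′ y≈y′ ⟩
    pushAll (reduce x′) (reduce y′)   ≡⟨ pushAll-reduce x′ (reduce-reduced y′) ⟨
    pushAll x′ (reduce y′)            ≡⟨ reduce-++ x′ y′ ⟨
    reduce (x′ ++ y′)                 ∎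
    where open ≡-Reasoning

  ·-congˡ : ∀ x {y y′ : Word k} → y ≈ y′ → x · y ≈ x · y′
  ·-congˡ x {y} {y′} = ·-cong {x} {x} {y} {y′} refl

  ·-congʳ : ∀ {x x′ : Word k} y → x ≈ x′ → x · y ≈ x′ · y
  ·-congʳ {x} {x′} y x≈x′ = ·-cong {x} {x′} {y} {y} x≈x′ refl

  inv-∷ : ∀ a w → inv (a ∷ w) ≡ inv w ∷ʳ invert a
  inv-∷ a w = unfold-reverse (invert a) (map invert w)

  ·-inverseʳ : ∀ (w : Word k) → w · inv w ≈ one
  ·-inverseʳ []      = refl
  ·-inverseʳ (a ∷ w) = begin
    push a (reduce (w ++ inv (a ∷ w)))              ≡⟨ cong (λ v → push a (reduce (w ++ v))) (inv-∷ a w) ⟩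
    push a (reduce (w ++ inv w ++ invert a ∷ []))   ≡⟨ cong (push a ∘ reduce) (++-assoc w (inv w) _) ⟨
    push a (reduce ((w ++ inv w) ++ invert a ∷ [])) ≡⟨ cong (push a) (·-congʳ {w ++ inv w} {[]} _ (·-inverseʳ w)) ⟩
    push a (invert a ∷ [])                          ≡⟨ push-cancel [] (cancels-invert a) ⟩
    []                                              ∎
    where open ≡-Reasoning

  ·-inverseˡ : ∀ (w : Word k) → inv w · w ≈ one
  ·-inverseˡ []      = refl
  ·-inverseˡ (a ∷ w) = begin
    reduce (inv (a ∷ w) ++ a ∷ w)                 ≡⟨ cong (λ v → reduce (v ++ a ∷ w)) (inv-∷ a w) ⟩
    reduce ((inv w ∷ʳ invert a) ++ a ∷ w)         ≡⟨ cong reduce (++-assoc (inv w) _ _) ⟩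
    reduce (inv w ++ invert a ∷ a ∷ w)            ≡⟨ ·-congˡ (inv w) (push-push (reduce w) cancel (reduce-reduced w)) ⟩
    reduce (inv w ++ w)                           ≡⟨ ·-inverseˡ w ⟩
    []                                            ∎
    where
    open ≡-Reasoning
    cancel : cancels (invert a) a ≡ true
    cancel = cancels-sym a (invert a) (cancels-invert a)

  ≈-isEquivalence : IsEquivalence (_≈_ {k})
  ≈-isEquivalence = On.isEquivalence reduce isEquivalence

  ≈-setoid : Setoid 0ℓ 0ℓ
  ≈-setoid = record { isEquivalence = ≈-isEquivalence }

  inv-cong : ∀ {x y : Word k} → x ≈ y → inv x ≈ inv y
  inv-cong {x} {y} x≈y = begin
    inv x                   ≡⟨ ++-identityʳ (inv x) ⟨
    inv x · one             ≈⟨ ·-congˡ (inv x) (·-inverseʳ y) ⟨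
    inv x · (y · inv y)     ≈⟨ ·-congˡ (inv x) (·-congʳ {x} {y} (inv y) x≈y) ⟨
    inv x · (x · inv y)     ≡⟨ ++-assoc (inv x) x (inv y) ⟨
    inv x · x · inv y       ≈⟨ ·-congʳ {inv x · x} {one} (inv y) (·-inverseˡ x) ⟩
    inv y                   ∎
    where open import Relation.Binary.Reasoning.Setoid ≈-setoid

freeGroup : ℕ → Group 0ℓ 0ℓ
freeGroup k = record
  { Carrier = Word k
  ; _≈_     = _≈_
  ; _∙_     = _·_
  ; ε       = one
  ; _⁻¹     = inv
  ; isGroup = record
    { isMonoid = record
      { isSemigroup = record
        { isMagma = record
          { isEquivalence = ≈-isEquivalence
          ; ∙-cong        = λ {x x′ y y′} → ·-cong {k} {x} {x′} {y} {y′}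
          }
        ; assoc   = λ x y z → cong reduce (++-assoc x y z)
        }
      ; identity = (λ _ → refl) , (λ x → cong reduce (++-identityʳ x))
      }
    ; inverse = ·-inverseˡ , ·-inverseʳ
    ; ⁻¹-cong = λ {x y} → inv-cong {k} {x} {y}
    }
  }

-- Cyclic decomposition and uniqueness of roots

module _ {k : ℕ} where

  open GroupFacts (freeGroup k)

  ^-[] : ∀ n → [] ^ n ≡ []
  ^-[] zero    = refl
  ^-[] (suc n) = ^-[] n

  ^-+ : ∀ (c : Word k) m n → c ^ (m + n) ≡ c ^ m ++ c ^ n
  ^-+ c zero    n = refl
  ^-+ c (suc m) n = trans (cong (c ++_) (^-+ c m n)) (sym (++-assoc c (c ^ m) (c ^ n)))

  ^-suc : ∀ (c : Word k) n → c ^ suc n ≡ c ^ n ++ c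
  ^-suc c n = trans (cong (_^_ c) (+-comm 1 n)) (trans (^-+ c n 1) (cong (c ^ n ++_) (++-identityʳ c)))

  length-^ : ∀ (c : Word k) n → length (c ^ n) ≡ n * length c
  length-^ c zero    = refl
  length-^ c (suc n) = trans (length-++ c) (cong (length c +_) (length-^ c n))

  head-^ : ∀ (c : Word k) n → head (c ^ suc n) ≡ head c
  head-^ []      n = cong head (^-[] n)
  head-^ (_ ∷ _) n = refl

  last-^ : ∀ (c : Word k) n → last (c ^ suc n) ≡ last c
  last-^ []      n = cong last (^-[] n)
  last-^ (h ∷ t) n = trans (cong last (^-suc (h ∷ t) n)) (last-++ ((h ∷ t) ^ n) h t)

  CyclicallyReduced : Word k → Set
  CyclicallyReduced c = Reduced (c ++ c)

  cyclicallyReduced⇒reduced : ∀ {c} → CyclicallyReduced c → Reduced c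
  cyclicallyReduced⇒reduced {c} cc = proj₁ (Linked-++⁻ c cc)

  cyclicallyReduced-ends : ∀ {c} → CyclicallyReduced c → Connected NonCancelling (last c) (head c)
  cyclicallyReduced-ends {c} cc = proj₁ (proj₂ (Linked-++⁻ c cc))

  ^-reduced : ∀ {c} → CyclicallyReduced c → ∀ n → Reduced (c ^ n)
  ^-reduced     cc zero          = []
  ^-reduced {c} cc (suc zero)    = subst Reduced (sym (++-identityʳ c)) (cyclicallyReduced⇒reduced cc)
  ^-reduced {c} cc (suc (suc n)) =
    Linked-++⁺ {xs = c} (cyclicallyReduced⇒reduced cc)
      (subst (Connected NonCancelling (last c)) (sym (head-^ c n)) (cyclicallyReduced-ends cc))
      (^-reduced cc (suc n))

  ^-cyclicallyReduced : ∀ {c} → CyclicallyReduced c → ∀ n → CyclicallyReduced (c ^ n)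
  ^-cyclicallyReduced {c} cc n = subst Reduced (^-+ c n n) (^-reduced cc (n + n))

  record CyclicDecomposition (w : Word k) : Set where
    field
      conjugator core : Word k
      cyclic          : CyclicallyReduced core
      splits          : w ≡ conjugator ++ core ++ inv conjugator

  conjugate-∷ : ∀ g u (c : Word k) → (g ∷ u) ++ c ++ inv (g ∷ u) ≡ g ∷ ((u ++ c ++ inv u) ∷ʳ invert g)
  conjugate-∷ g u c = cong (g ∷_) (begin
    u ++ c ++ inv (g ∷ u)              ≡⟨ cong (λ v → u ++ c ++ v) (inv-∷ g u) ⟩
    u ++ c ++ (inv u ∷ʳ invert g)      ≡⟨ solve (++-monoid (Letter k)) ⟩
    (u ++ c ++ inv u) ∷ʳ invert g      ∎)
    where open ≡-Reasoning

  -- n is fuel: the recursive call is on w with its first and last letters removed.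
  decompose : ∀ n w → length w ≤ n → Reduced w → CyclicDecomposition w
  decompose _ [] _ _ = record { conjugator = [] ; core = [] ; cyclic = [] ; splits = refl }
  decompose (suc n) (g ∷ w) (s≤s len) r with reverseView w
  ... | [] = record { conjugator = [] ; core = g ∷ [] ; cyclic = cancels-self g ∷ [-] ; splits = refl }
  ... | m ∶ _ ∶ʳ l with cancels l g in lg
  ...   | false = record
    { conjugator = [] ; core = g ∷ m ∷ʳ l ; cyclic = Linked-++⁺ r ends r ; splits = sym (++-identityʳ _) }
    where
    ends : Connected NonCancelling (last (g ∷ m ∷ʳ l)) (just g)
    ends = subst (λ x → Connected NonCancelling x (just g)) (sym (last-++ (g ∷ m) l [])) (just lg)
  ...   | true = record
    { conjugator = g ∷ conjugator ; core = core ; cyclic = cyclic ; splits = g∷m∷ʳl-splits }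
    where
    open CyclicDecomposition
      (decompose n m (≤-trans (length-++-≤ˡ m) len) (proj₁ (Linked-++⁻ m (Linked.tail r))))
    open ≡-Reasoning
    M : Word k
    M = conjugator ++ core ++ inv conjugator
    l≡g⁻¹ : l ≡ invert g
    l≡g⁻¹ = cancels⇒≡invert g l (cancels-sym l g lg)
    g∷m∷ʳl-splits : g ∷ m ∷ʳ l ≡ (g ∷ conjugator) ++ core ++ inv (g ∷ conjugator)
    g∷m∷ʳl-splits = begin
      g ∷ m ∷ʳ l                                             ≡⟨ cong (λ v → g ∷ v ∷ʳ l) splits ⟩
      g ∷ (conjugator ++ core ++ inv conjugator) ∷ʳ l        ≡⟨ cong (λ x → g ∷ M ∷ʳ x) l≡g⁻¹ ⟩
      g ∷ (conjugator ++ core ++ inv conjugator) ∷ʳ invert g ≡⟨ conjugate-∷ g conjugator core ⟨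
      (g ∷ conjugator) ++ core ++ inv (g ∷ conjugator)       ∎

  cyclicDecomposition : ∀ {w} → Reduced w → CyclicDecomposition w
  cyclicDecomposition {w} = decompose (length w) w ≤-refl

  ¬cyclicallyReduced-conjugate : ∀ g m → ¬ CyclicallyReduced (g ∷ m ∷ʳ invert g)
  ¬cyclicallyReduced-conjugate g m cc
    with subst (λ x → Connected NonCancelling x (just g)) (last-++ (g ∷ m) (invert g) [])
               (cyclicallyReduced-ends cc)
  ... | just noncancelling with trans (sym noncancelling) (cancels-sym g (invert g) (cancels-invert g))
  ... | ()

  conjugate-injective : ∀ u v {c d} → CyclicallyReduced c → CyclicallyReduced d →
                        u ++ c ++ inv u ≡ v ++ d ++ inv v → u ≡ v × c ≡ d
  conjugate-injective []      []            _  _  e = refl , trans (sym (++-identityʳ _)) (trans e (++-identityʳ _))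
  conjugate-injective (g ∷ u) [] {c} {d}    _  cd e = contradiction
    (subst CyclicallyReduced (trans (sym (++-identityʳ d)) (trans (sym e) (conjugate-∷ g u c))) cd)
    (¬cyclicallyReduced-conjugate g _)
  conjugate-injective [] (g ∷ v) {c} {d}    cc _  e = contradiction
    (subst CyclicallyReduced (trans (sym (++-identityʳ c)) (trans e (conjugate-∷ g v d))) cc)
    (¬cyclicallyReduced-conjugate g _)
  conjugate-injective (g ∷ u) (g′ ∷ v) {c} {d} cc cd e
    with ∷-injective (trans (sym (conjugate-∷ g u c)) (trans e (conjugate-∷ g′ v d)))
  ... | refl , e′ with conjugate-injective u v cc cd (∷ʳ-injectiveˡ _ _ e′)
  ... | refl , c≡d = refl , c≡d

  ^-injective : ∀ n {c d : Word k} → c ^ suc n ≡ d ^ suc n → c ≡ d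
  ^-injective n {c} {d} e = ++-injectiveˡ c d same-length e
    where
    same-length : length c ≡ length d
    same-length = *-cancelˡ-≡ (length c) (length d) (suc n)
      (trans (sym (length-^ c (suc n))) (trans (cong length e) (length-^ d (suc n))))

  reduce-^ : ∀ {w} → Reduced w → (D : CyclicDecomposition w) → let open CyclicDecomposition D in
             ∀ n → reduce (w ^ suc n) ≡ conjugator ++ core ^ suc n ++ inv conjugator
  reduce-^ {w} r D n = begin
    reduce (w ^ suc n)                   ≡⟨ cong (λ v → reduce (v ^ suc n)) (trans splits (sym (++-assoc u c (inv u)))) ⟩
    reduce (((u ++ c) ++ inv u) ^ suc n) ≡⟨ conjugate-^ u c (suc n) ⟩
    reduce ((u ++ c ^ suc n) ++ inv u)   ≡⟨ cong reduce (++-assoc u (c ^ suc n) (inv u)) ⟩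
    reduce (u ++ c ^ suc n ++ inv u)     ≡⟨ reduce-id ucⁿu⁻¹-reduced ⟩
    u ++ c ^ suc n ++ inv u              ∎
    where
    open CyclicDecomposition D renaming (conjugator to u; core to c)
    open ≡-Reasoning
    ucⁿu⁻¹-reduced : Reduced (u ++ c ^ suc n ++ inv u)
    ucⁿu⁻¹-reduced = Linked-replace u (head-^ c n) (last-^ c n) (^-reduced cyclic (suc n)) (subst Reduced splits r)

  reduced-^-injective : ∀ n {r s} → Reduced r → Reduced s →
                        reduce (r ^ suc n) ≡ reduce (s ^ suc n) → r ≡ s
  reduced-^-injective n {r} {s} rr rs e = begin
    r                                           ≡⟨ R.splits ⟩
    R.conjugator ++ R.core ++ inv R.conjugator  ≡⟨ cong₂ (λ u c → u ++ c ++ inv u) u≡v (^-injective n cⁿ≡dⁿ) ⟩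
    S.conjugator ++ S.core ++ inv S.conjugator  ≡⟨ S.splits ⟨
    s                                           ∎
    where
    Dʳ : CyclicDecomposition r
    Dʳ = cyclicDecomposition rr
    Dˢ : CyclicDecomposition s
    Dˢ = cyclicDecomposition rs
    module R = CyclicDecomposition Dʳ
    module S = CyclicDecomposition Dˢ
    open ≡-Reasoning
    u≡v×cⁿ≡dⁿ : R.conjugator ≡ S.conjugator × R.core ^ suc n ≡ S.core ^ suc n
    u≡v×cⁿ≡dⁿ = conjugate-injective R.conjugator S.conjugator {R.core ^ suc n} {S.core ^ suc n}
      (^-cyclicallyReduced {R.core} R.cyclic (suc n)) (^-cyclicallyReduced {S.core} S.cyclic (suc n))
      (trans (sym (reduce-^ rr Dʳ n)) (trans e (reduce-^ rs Dˢ n)))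
    u≡v : R.conjugator ≡ S.conjugator
    u≡v = proj₁ u≡v×cⁿ≡dⁿ
    cⁿ≡dⁿ : R.core ^ suc n ≡ S.core ^ suc n
    cⁿ≡dⁿ = proj₂ u≡v×cⁿ≡dⁿ

  uniqueRoots : ∀ n → UniqueRoots (suc n)
  uniqueRoots n x y xⁿ≈yⁿ = reduced-^-injective n (reduce-reduced x) (reduce-reduced y) (begin
    reduce (reduce x ^ suc n)  ≡⟨ ×-congʳ (suc n) {reduce x} {x} (reduce-id (reduce-reduced x)) ⟩
    reduce (x ^ suc n)         ≡⟨ xⁿ≈yⁿ ⟩
    reduce (y ^ suc n)         ≡⟨ ×-congʳ (suc n) {y} {reduce y} (sym (reduce-id (reduce-reduced y))) ⟩
    reduce (reduce y ^ suc n)  ∎)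
    where
    open MonoidMult (Group.monoid (freeGroup k)) using (×-congʳ)
    open ≡-Reasoning

-- An action of the free group on ℤ

module _ {k′ : ℕ} where

  open GroupFacts (freeGroup (suc (suc k′)))
  open import Data.Integer using (ℤ; +_; -_; _⊖_) renaming (suc to sucℤ; pred to predℤ; _+_ to _+ℤ_)
  import Data.Integer.Properties as ℤ

  actLetter : Letter (suc (suc k′)) → ℤ → ℤ
  actLetter (zero , _)           x = - x
  actLetter (suc zero , false)   x = sucℤ x
  actLetter (suc zero , true)    x = predℤ x
  actLetter (suc (suc _) , _)    x = x

  actLetter-invert : ∀ a x → actLetter a (actLetter (invert a) x) ≡ x
  actLetter-invert (zero , _)         x = ℤ.neg-involutive x
  actLetter-invert (suc zero , false) x = ℤ.suc-pred x
  actLetter-invert (suc zero , true)  x = ℤ.pred-suc x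
  actLetter-invert (suc (suc _) , _)  x = refl

  act : Word (suc (suc k′)) → ℤ → ℤ
  act w x = foldr actLetter x w

  act-push : ∀ a w x → act (push a w) x ≡ actLetter a (act w x)
  act-push a []      x = refl
  act-push a (b ∷ w) x with cancels a b in ab
  ... | false = refl
  ... | true rewrite cancels⇒≡invert a b ab = sym (actLetter-invert a (act w x))

  act-reduce : ∀ w x → act (reduce w) x ≡ act w x
  act-reduce []      x = refl
  act-reduce (a ∷ w) x = trans (act-push a (reduce w) x) (cong (actLetter a) (act-reduce w x))

  act-cong : ∀ {u v} → u ≈ v → ∀ x → act u x ≡ act v x
  act-cong {u} {v} u≈v x = trans (sym (act-reduce u x)) (trans (cong (λ w → act w x) u≈v) (act-reduce v x))

  a₀ a₁ : Letter (suc (suc k′))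
  a₀ = (zero , false)
  a₁ = (suc zero , false)

  h : ℕ → Word (suc (suc k′))
  h n = (a₁ ∷ []) ^ n ++ a₀ ∷ []

  act-h : ∀ n x → act (h n) x ≡ + n +ℤ - x
  act-h n x = trans (foldr-++ actLetter x ((a₁ ∷ []) ^ n) (a₀ ∷ [])) (translate n (- x))
    where
    translate : ∀ n y → act ((a₁ ∷ []) ^ n) y ≡ + n +ℤ y
    translate zero    y = sym (ℤ.+-identityˡ y)
    translate (suc n) y = trans (cong sucℤ (translate n y)) (sym (ℤ.suc-+ n y))

  act-h·h : ∀ m n → act (h m · h n) (+ 0) ≡ m ⊖ n
  act-h·h m n = begin
    act (h m ++ h n) (+ 0)      ≡⟨ foldr-++ actLetter (+ 0) (h m) (h n) ⟩
    act (h m) (act (h n) (+ 0)) ≡⟨ cong (act (h m)) (trans (act-h n (+ 0)) (ℤ.+-identityʳ (+ n))) ⟩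
    act (h m) (+ n)             ≡⟨ act-h m (+ n) ⟩
    + m +ℤ - + n                ≡⟨ ℤ.m-n≡m⊖n m n ⟩
    m ⊖ n                       ∎
    where open ≡-Reasoning

  ⊖-asymmetric : ∀ {m n} → m < n → m ⊖ n ≢ n ⊖ m
  ⊖-asymmetric {zero}  {suc n} _         ()
  ⊖-asymmetric {suc m} {suc n} (s<s m<n)
    rewrite ℤ.[1+m]⊖[1+n]≡m⊖n m n | ℤ.[1+m]⊖[1+n]≡m⊖n n m = ⊖-asymmetric m<n

  h-noncommuting : ∀ {m n} → m < n → ¬ Commute (h m) (h n)
  h-noncommuting {m} {n} m<n hm·hn≈hn·hm = ⊖-asymmetric m<n (begin
    m ⊖ n                     ≡⟨ act-h·h m n ⟨
    act (h m · h n) (+ 0)     ≡⟨ act-cong {h m · h n} {h n · h m} hm·hn≈hn·hm (+ 0) ⟩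
    act (h n · h m) (+ 0)     ≡⟨ act-h·h n m ⟩
    n ⊖ m                     ∎)
    where open ≡-Reasoning

lemma2 : (k : ℕ) → 2 ≤ k → ¬ Equational.IsEquational (NE {k})
lemma2 (suc (suc k′)) (s≤s (s≤s _)) = ladder⇒¬equational NE p q below off-diagonal
  where
  open GroupFacts (freeGroup (suc (suc k′)))
  q p : ℕ → Word (suc (suc k′))
  q i = (h i ^ 9) ^ 10
  p j = inv (h j ^ 10) ^ 9
  below : ∀ {i j} → i < j → NE (p j) (q i)
  -- refl: on numerals x ^ n unfolds to pow n x, so q i · p j already has the shape NE asks for.
  below {i} {j} i<j = h i ^ 9 , h j ^ 10 , refl , λ [x,y]≈ε →
    h-noncommuting i<j (^-commute⇒commute 9 10 {h i} {h j} (uniqueRoots 8) (uniqueRoots 9)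
                         ([,]≈ε⇒commute {h i ^ 9} {h j ^ 10} [x,y]≈ε))
  off-diagonal : ∀ j → ¬ NE (p j) (q j)
  off-diagonal j (x , y , qp≈x¹⁰y⁻⁹ , [x,y]≉ε) = [x,y]≉ε (commute⇒[,]≈ε {x} {y}
    (xᵐ∙y⁻¹ⁿ≈ε⇒commute 10 9 {x} {y} (uniqueRoots 8) (trans (sym qp≈x¹⁰y⁻⁹) (xᵐⁿ∙xⁿ⁻¹ᵐ≈ε (h j) 9 10))))
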